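{- Let $q=2^m$ for some integer $m\ge 2$. Consider the affine space $\mathbb{F}_q^3$ with its projective plane at infinity $\pi$. Fix a point $x\in\mathbb{F}_q^3$, and let $H^*$ be a set of $q+2$ lines of $\pi$ such that every point of $\pi$ lies on either $0$ or $2$ lines of $H^*$. Call a point of $\pi$ exterior if it lies on no line of $H^*$. Let $Y$ be the set of points $y\in\mathbb{F}_q^3$, $y\neq x$, such that the affine line through $x$ and $y$ meets $\pi$ in an exterior point, and let $Z$ be the set of affine planes of $\mathbb{F}_q^3$ whose line at infinity belongs to $H^*$ and which do not contain $x$. Let $G$ be the bipartite incidence graph on $Y\cup Z$ (a point is adjacent to a plane iff it lies on it). Then $G$ is distance-biregular with intersection array \[ \begin{vmatrix} q+2; & 1, & 2, & \frac{(q+1)q}{4}, & q+2 \\ \frac{q(q-1)}{2}; & 1, & \frac q2, & q+1, & \frac{q(q-1)}{2}\end{vmatrix}. \]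
   Context: A bipartite graph with bipartition $Y\cup Z$ is distance-biregular if for every vertex $a$, every $i$, and every vertex $w$ at distance $i$ from $a$, the numbers $c_i(a)=|\{u\sim w: d(a,u)=i-1\}|$ and $b_i(a)=|\{u\sim w: d(a,u)=i+1\}|$ depend only on $i$ and on which part contains $a$. The intersection array $\begin{vmatrix} k; & c_1^{Y}, & \dots, & c_{d_Y}^{Y} \\ \ell; & c_1^{Z}, & \dots, & c_{d_Z}^{Z}\end{vmatrix}$ records the valency $k$ of vertices in $Y$, the valency $\ell$ of vertices in $Z$, and the numbers $c_i$ (for vertices in $Y$, resp. $Z$) for $1\le i\le d_Y$ (resp. $d_Z$), the eccentricities of vertices in $Y$ (resp. $Z$). -}

module Defs where

open import Level using (0ℓ)
open import Data.Nat using (ℕ; zero; suc; _≤_; _∸_)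
open import Data.Fin using (Fin; toℕ)
open import Data.Vec using (Vec; lookup)
open import Data.List using (List; length)
open import Data.List.Membership.Propositional using (_∈_)
open import Data.List.Relation.Unary.Unique.Propositional using (Unique)
open import Data.Product using (Σ; ∃; _×_; _,_)
open import Data.Sum using (_⊎_; inj₁; inj₂)
open import Data.Empty using (⊥)
open import Relation.Nullary using (¬_)
open import Relation.Binary.PropositionalEquality using (_≡_; _≢_)
open import Function.Bundles using (_↔_; _⇔_)
open import Algebra.Structures using (IsCommutativeRing)

HasSize : {A : Set} → (A → Set) → ℕ → Set
HasSize {A} P k =
  Σ (List A) λ xs → length xs ≡ k × Unique xs × (∀ u → P u ⇔ (u ∈ xs))

record FiniteField (q : ℕ) : Set₁ where
  infixl 6 _+_
  infixl 7 _*_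
  field
    Carrier : Set
    _+_ _*_ : Carrier → Carrier → Carrier
    -_      : Carrier → Carrier
    0# 1#   : Carrier
    isCommutativeRing : IsCommutativeRing _≡_ _+_ _*_ -_ 0# 1#
    0≢1     : 0# ≢ 1#
    inverse : ∀ x → x ≢ 0# → Σ Carrier λ y → x * y ≡ 1#
    enum    : Fin q ↔ Carrier

module Geometry {q : ℕ} (F : FiniteField q) where
  open FiniteField F

  V3 : Set
  V3 = Carrier × Carrier × Carrier

  0v : V3
  0v = 0# , 0# , 0#

  _·_ : V3 → V3 → Carrier
  (a₁ , a₂ , a₃) · (b₁ , b₂ , b₃) = a₁ * b₁ + a₂ * b₂ + a₃ * b₃

  _-v_ : V3 → V3 → V3
  (a₁ , a₂ , a₃) -v (b₁ , b₂ , b₃) = (a₁ + - b₁) , (a₂ + - b₂) , (a₃ + - b₃)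

  _•_ : Carrier → V3 → V3
  c • (b₁ , b₂ , b₃) = (c * b₁) , (c * b₂) , (c * b₃)

  -- u and v represent the same projective point / line of π
  Proportional : V3 → V3 → Set
  Proportional u v = Σ Carrier λ c → c ≢ 0# × u ≡ c • v

  -- A point of π is a nonzero direction d (up to scalars); a line of π
  -- is a nonzero normal vector n (up to scalars), i.e. the line at
  -- infinity of the parallel class of affine planes {p | n · p = c}.
  -- Incidence in π:  d lies on n  iff  n · d = 0.

  IsDualHyperoval : (Fin (suc (suc q)) → V3) → Set
  IsDualHyperoval h =
    (∀ i → h i ≢ 0v) ×
    (∀ i j → i ≢ j → ¬ Proportional (h i) (h j)) ×
    (∀ d → d ≢ 0v →
       HasSize (λ i → h i · d ≡ 0#) 0 ⊎ HasSize (λ i → h i · d ≡ 0#) 2)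

  Exterior : (Fin (suc (suc q)) → V3) → V3 → Set
  Exterior h d = ∀ i → ¬ (h i · d ≡ 0#)

record BipartiteGraph : Set₁ where
  field
    P Q : Set
    InY : P → Set
    InZ : Q → Set
    Inc : P → Q → Set

module BG (G : BipartiteGraph) where
  open BipartiteGraph G

  A : Set
  A = P ⊎ Q

  Vtx : A → Set
  Vtx (inj₁ y) = InY y
  Vtx (inj₂ z) = InZ z

  Adj : A → A → Set
  Adj (inj₁ y) (inj₂ z) = InY y × InZ z × Inc y z
  Adj (inj₂ z) (inj₁ y) = InY y × InZ z × Inc y z
  Adj (inj₁ _) (inj₁ _) = ⊥
  Adj (inj₂ _) (inj₂ _) = ⊥

  data Walk : A → A → ℕ → Set where
    nil  : ∀ {a} → Walk a a 0
    cons : ∀ {a b c n} → Adj a b → Walk b c n → Walk a c (suc n)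

  Dist : A → A → ℕ → Set
  Dist a w i = Walk a w i × (∀ j → Suc≤ j i → ¬ Walk a w j)
    where
    Suc≤ : ℕ → ℕ → Set
    Suc≤ j i = suc j ≤ i

  Regular : A → (ℕ → ℕ) → (ℕ → ℕ) → Set
  Regular a c b = ∀ i w → Dist a w i →
    HasSize (λ u → Adj w u × Dist a u (i ∸ 1)) (c i) ×
    HasSize (λ u → Adj w u × Dist a u (suc i)) (b i)

  Eccentricity : A → ℕ → Set
  Eccentricity a d =
    (∀ w → Vtx w → Σ ℕ λ i → i ≤ d × Dist a w i) ×
    Σ A (λ w → Vtx w × Dist a w d)

  IsDistanceBiregular : Set
  IsDistanceBiregular =
    Σ (ℕ → ℕ) λ cY → Σ (ℕ → ℕ) λ bY → Σ (ℕ → ℕ) λ cZ → Σ (ℕ → ℕ) λ bZ →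
      (∀ y → InY y → Regular (inj₁ y) cY bY) ×
      (∀ z → InZ z → Regular (inj₂ z) cZ bZ)

  -- G is distance-biregular with intersection array
  --   | k; cYv(1) ... cYv(dY) |
  --   | ℓ; cZv(1) ... cZv(dZ) |
  HasIntersectionArray : ∀ {dY dZ} → ℕ → Vec ℕ dY → ℕ → Vec ℕ dZ → Set
  HasIntersectionArray {dY} {dZ} k cYv ℓ cZv =
    Σ (ℕ → ℕ) λ cY → Σ (ℕ → ℕ) λ bY → Σ (ℕ → ℕ) λ cZ → Σ (ℕ → ℕ) λ bZ →
      (∀ y → InY y → Regular (inj₁ y) cY bY) ×
      (∀ z → InZ z → Regular (inj₂ z) cZ bZ) ×
      (∀ y → InY y → HasSize (Adj (inj₁ y)) k × Eccentricity (inj₁ y) dY) ×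
      (∀ z → InZ z → HasSize (Adj (inj₂ z)) ℓ × Eccentricity (inj₂ z) dZ) ×
      (∀ (i : Fin dY) → cY (suc (toℕ i)) ≡ lookup cYv i) ×
      (∀ (i : Fin dZ) → cZ (suc (toℕ i)) ≡ lookup cZv i)

-- The graph of Theorem 6.4.
-- Y-side ambient type: points of F_q^3; Z-side ambient type: pairs (i , c)
-- encoding the affine plane {p | h i · p = c} (each plane whose line at
-- infinity is in H* arises from exactly one such pair).

module _ {q : ℕ} (F : FiniteField q) where
  open FiniteField F
  open Geometry F

  planeGraph : V3 → (Fin (suc (suc q)) → V3) → BipartiteGraph
  planeGraph x h = record
    { P   = V3
    ; Q   = Fin (suc (suc q)) × Carrier
    ; InY = λ y → y ≢ x × Exterior h (y -v x)
    ; InZ = λ { (i , c) → ¬ (h i · x ≡ c) }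
    ; Inc = λ { y (i , c) → h i · y ≡ c }
    }

{-# OPTIONS --safe #-}
module Submission where

-- Describe a point w of F_q³ by its coordinates h_j · w, one for each line j of H*.  As
-- every point of π lies on 0 or 2 lines of H*, no three lines of H* are concurrent, so any
-- three coordinates determine w: a plane h_i · w = c has q² points, two non-parallel such
-- planes meet in q points and three meet in one.  For w ≠ p the coordinates of w and p agree
-- in 0 or 2 places, according as the line pw meets π in an exterior point or not, so double
-- counting agreements over a plane (or line) avoiding p counts its points w with pw
-- exterior.  For p = x these are the points of Y: there are q(q−1)/2 on a plane of Z and q/2
-- on the meet of two non-parallel planes of Z; counting pairs of agreements with x and with
-- y ∈ Y gives (q+1)q/4 points of Y on a plane of Z avoiding y that are not exterior to y.
-- The distance of a vertex from a fixed y ∈ Y (or z ∈ Z) is then read off from its position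
-- relative to y (z), and each intersection number is one of these counts.

open import Defs

open import Level using (0ℓ)
open import Algebra.Bundles using (CommutativeRing)
import Data.Nat.Properties as ℕ
open import Data.Nat.DivMod using (m*n/n≡m)
open import Data.Nat.Tactic.RingSolver using (solve-∀)
open import Data.Fin as Fin using (Fin)
open import Data.Fin.Properties using (inj⇒≟; all?)
open import Data.List as List using (List; []; _∷_; length; map; filter; cartesianProduct; allFin)
import Data.List.Properties as List
open import Data.List.Membership.Propositional using (_∈_)
open import Data.List.Membership.Propositional.Properties
  using (∈-filter⁺; ∈-filter⁻; ∈-map⁺; ∈-map⁻; ∈-cartesianProduct⁺; ∈-cartesianProduct⁻; ∈-allFin)
import Data.List.Membership.DecPropositional as DecMembership
open import Data.List.Relation.Binary.Subset.Propositional using (_⊆_)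
open import Data.List.Relation.Unary.Any using (here; there; _─_; index)
open import Data.List.Relation.Unary.All as All using (All; []; _∷_)
open import Data.List.Relation.Unary.All.Properties using (¬Any⇒All¬)
open import Data.List.Relation.Unary.AllPairs using ([]; _∷_)
open import Data.List.Relation.Unary.Unique.Propositional using (Unique)
import Data.List.Relation.Unary.Unique.Propositional.Properties as Unique
open import Data.Product using (∃; ∃-syntax; _×_; _,_; proj₁; proj₂)
import Data.Product.Properties as ×
open import Data.Sum using (_⊎_; inj₁; inj₂; [_,_]′)
open import Data.Sum.Properties using (inj₁-injective; inj₂-injective)
open import Data.Vec using (_∷_; [])
open import Data.Unit using (⊤; tt)
open import Data.Empty using (⊥; ⊥-elim)
open import Relation.Nullary using (¬_; Dec; yes; no; _×-dec_; _⊎-dec_; ¬?; decidable-stable)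
open import Relation.Unary using (Decidable)
open import Relation.Binary.Definitions using (DecidableEquality)
open import Relation.Binary.PropositionalEquality
open import Function.Base using (_∘_; id)
open import Function.Bundles using (_⇔_; mk⇔; Equivalence; _↔_; Inverse; Injection)
open import Function.Properties.Inverse using (↔⇒↣; ↔-sym)

module FieldAlgebra {q} (F : FiniteField q) where
  open FiniteField F
  open Geometry F

  private
    commutativeRing : CommutativeRing 0ℓ 0ℓ
    commutativeRing = record { isCommutativeRing = isCommutativeRing }
    open CommutativeRing commutativeRing using (ring; +-abelianGroup; +-commutativeSemigroup)
    open import Algebra.Properties.Ring ring using (x[y-z]≈xy-xz; -‿+-comm)
    open import Algebra.Properties.AbelianGroup +-abelianGroup using (x∙y⁻¹≈ε⇒x≈y; x≈y⇒x∙y⁻¹≈ε)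
    open import Algebra.Properties.CommutativeSemigroup +-commutativeSemigroup using (interchange)

  infix 4 _≟F_ _≟V_

  abstract
    _≟F_ : DecidableEquality Carrier
    _≟F_ = inj⇒≟ (↔⇒↣ (↔-sym enum))

  _≟V_ : DecidableEquality V3
  _≟V_ = ×.≡-dec _≟F_ (×.≡-dec _≟F_ _≟F_)

  [a-b]+[c-d]≡[a+c]-[b+d] : ∀ a b c d → (a + - b) + (c + - d) ≡ (a + c) + - (b + d)
  [a-b]+[c-d]≡[a+c]-[b+d] a b c d = trans (interchange a (- b) c (- d)) (cong ((a + c) +_) (-‿+-comm b d))

  ·-distrib-v : ∀ h a b → h · (a -v b) ≡ h · a + - (h · b)
  ·-distrib-v (h₁ , h₂ , h₃) (a₁ , a₂ , a₃) (b₁ , b₂ , b₃) = begin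
    h₁ * (a₁ + - b₁) + h₂ * (a₂ + - b₂) + h₃ * (a₃ + - b₃)
      ≡⟨ cong₂ _+_ (cong₂ _+_ (x[y-z]≈xy-xz h₁ a₁ b₁) (x[y-z]≈xy-xz h₂ a₂ b₂)) (x[y-z]≈xy-xz h₃ a₃ b₃) ⟩
    (h₁ * a₁ + - (h₁ * b₁)) + (h₂ * a₂ + - (h₂ * b₂)) + (h₃ * a₃ + - (h₃ * b₃))
      ≡⟨ cong (_+ (h₃ * a₃ + - (h₃ * b₃))) ([a-b]+[c-d]≡[a+c]-[b+d] _ _ _ _) ⟩
    (h₁ * a₁ + h₂ * a₂ + - (h₁ * b₁ + h₂ * b₂)) + (h₃ * a₃ + - (h₃ * b₃))
      ≡⟨ [a-b]+[c-d]≡[a+c]-[b+d] _ _ _ _ ⟩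
    (h₁ * a₁ + h₂ * a₂ + h₃ * a₃) + - (h₁ * b₁ + h₂ * b₂ + h₃ * b₃) ∎
    where open ≡-Reasoning

  ·-v≡0⇔ : ∀ h a b → h · (a -v b) ≡ 0# ⇔ h · a ≡ h · b
  ·-v≡0⇔ h a b = mk⇔ (λ eq → x∙y⁻¹≈ε⇒x≈y _ _ (trans (sym (·-distrib-v h a b)) eq))
                     (λ eq → trans (·-distrib-v h a b) (x≈y⇒x∙y⁻¹≈ε eq))

  -v≡0v⇒≡ : ∀ {a b} → a -v b ≡ 0v → a ≡ b
  -v≡0v⇒≡ {a₁ , a₂ , a₃} {b₁ , b₂ , b₃} eq =
    let e₁ , e₂₃ = ×.×-≡,≡←≡ eq ; e₂ , e₃ = ×.×-≡,≡←≡ e₂₃ in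
    ×.×-≡,≡→≡ (x∙y⁻¹≈ε⇒x≈y a₁ b₁ e₁ , ×.×-≡,≡→≡ (x∙y⁻¹≈ε⇒x≈y a₂ b₂ e₂ , x∙y⁻¹≈ε⇒x≈y a₃ b₃ e₃))

-- Imported only now: the field's _+_ and _*_, opened in FieldAlgebra, would clash with these.
open import Data.Nat as ℕ using (ℕ; zero; suc; _+_; _*_; _∸_; _^_; _/_; _≤_; _<_; z≤n; s≤s)

private variable
  A B : Set
  P Q : A → Set
  k m n : ℕ

-- Finite sets and counting

∈-─ : ∀ {x z : A} {ys} (x∈ys : x ∈ ys) → z ∈ ys → x ≢ z → z ∈ (ys ─ x∈ys)
∈-─ (here refl)  (here refl)  x≢z = ⊥-elim (x≢z refl)
∈-─ (here refl)  (there z∈ys) _   = z∈ys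
∈-─ (there _)    (here refl)  _   = here refl
∈-─ (there x∈ys) (there z∈ys) x≢z = there (∈-─ x∈ys z∈ys x≢z)

Unique⇒length≤ : {xs ys : List A} → Unique xs → xs ⊆ ys → length xs ≤ length ys
Unique⇒length≤ {xs = []}     _          _     = z≤n
Unique⇒length≤ {xs = x ∷ xs} {ys} (x∉xs ∷ u) xs⊆ys =
  subst (suc (length xs) ≤_) (sym (List.length-removeAt′ ys (index x∈ys)))
    (s≤s (Unique⇒length≤ u (λ z∈xs → ∈-─ x∈ys (xs⊆ys (there z∈xs)) (All.lookup x∉xs z∈xs))))
  where x∈ys = xs⊆ys (here refl)

Cardinality : Set → ℕ → Set
Cardinality A n = HasSize (λ (_ : A) → ⊤) n

elements : HasSize P n → List _
elements = proj₁

module _ {P : A → Set} (hs : HasSize P n) where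
  length-elements : length (elements hs) ≡ n
  length-elements = proj₁ (proj₂ hs)

  unique-elements : Unique (elements hs)
  unique-elements = proj₁ (proj₂ (proj₂ hs))

  ∈-elements⁺ : ∀ {u} → P u → u ∈ elements hs
  ∈-elements⁺ {u} = Equivalence.to (proj₂ (proj₂ (proj₂ hs)) u)

  ∈-elements⁻ : ∀ {u} → u ∈ elements hs → P u
  ∈-elements⁻ {u} = Equivalence.from (proj₂ (proj₂ (proj₂ hs)) u)

  length≤size : {xs : List A} → Unique xs → All P xs → length xs ≤ n
  length≤size uniq all = subst (_ ≤_) length-elements (Unique⇒length≤ uniq (∈-elements⁺ ∘ All.lookup all))

HasSize-unique : HasSize P m → HasSize P n → m ≡ n
HasSize-unique hm hn = ℕ.≤-antisym (bound hm hn) (bound hn hm)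
  where
  bound : HasSize P m → HasSize P n → m ≤ n
  bound hm hn = subst (_≤ _) (length-elements hm) (length≤size hn (unique-elements hm) (All.tabulate (∈-elements⁻ hm)))

HasSize-cong : (∀ {u} → P u → Q u) → (∀ {u} → Q u → P u) → HasSize P n → HasSize Q n
HasSize-cong P⇒Q Q⇒P (xs , len , uniq , mem) =
  xs , len , uniq , λ u → mk⇔ (Equivalence.to (mem u) ∘ Q⇒P) (P⇒Q ∘ Equivalence.from (mem u))

HasSize-image : (f : A → B) → (∀ {a a′} → f a ≡ f a′ → a ≡ a′) →
  (∀ {a} → P a → Q (f a)) → (∀ {b} → Q b → ∃[ a ] P a × b ≡ f a) →
  HasSize P n → HasSize Q n
HasSize-image {Q = Q} f f-injective P⇒Q Q⇒P (xs , len , uniq , mem) =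
  map f xs , trans (List.length-map f xs) len , Unique.map⁺ f-injective uniq , λ b → mk⇔
    (λ Qb → let a , Pa , b≡fa = Q⇒P Qb in subst (_∈ map f xs) (sym b≡fa) (∈-map⁺ f (Equivalence.to (mem a) Pa)))
    (λ b∈ → let a , a∈ , b≡fa = ∈-map⁻ f b∈ in subst Q (sym b≡fa) (P⇒Q (Equivalence.from (mem a) a∈)))

length-cartesianProduct : (xs : List A) (ys : List B) → length (cartesianProduct xs ys) ≡ length xs * length ys
length-cartesianProduct []       ys = refl
length-cartesianProduct (x ∷ xs) ys = begin
  length (map (x ,_) ys List.++ cartesianProduct xs ys)     ≡⟨ List.length-++ (map (x ,_) ys) ⟩
  length (map (x ,_) ys) + length (cartesianProduct xs ys)  ≡⟨ cong₂ _+_ (List.length-map (x ,_) ys) (length-cartesianProduct xs ys) ⟩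
  length ys + length xs * length ys                          ∎
  where open ≡-Reasoning

HasSize-× : HasSize P m → HasSize Q n → HasSize (λ (a , b) → P a × Q b) (m * n)
HasSize-× (xs , lenx , uniqx , memx) (ys , leny , uniqy , memy) =
  cartesianProduct xs ys ,
  trans (length-cartesianProduct xs ys) (cong₂ _*_ lenx leny) ,
  Unique.cartesianProduct⁺ uniqx uniqy ,
  λ (a , b) → mk⇔
    (λ (Pa , Qb) → ∈-cartesianProduct⁺ (Equivalence.to (memx a) Pa) (Equivalence.to (memy b) Qb))
    (λ ab∈ → let a∈ , b∈ = ∈-cartesianProduct⁻ xs ys ab∈ in Equivalence.from (memx a) a∈ , Equivalence.from (memy b) b∈)

HasSize-≡ : (a : A) → HasSize (_≡ a) 1
HasSize-≡ a = a ∷ [] , refl , [] ∷ [] , λ u → mk⇔ here (λ { (here u≡a) → u≡a ; (there ()) })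

HasSize-pair : {a b : A} → a ≢ b → HasSize (λ u → u ≡ a ⊎ u ≡ b) 2
HasSize-pair {a = a} {b} a≢b = a ∷ b ∷ [] , refl , (a≢b ∷ []) ∷ [] ∷ [] , λ u → mk⇔
  (λ { (inj₁ u≡a) → here u≡a ; (inj₂ u≡b) → there (here u≡b) })
  (λ { (here u≡a) → inj₁ u≡a ; (there (here u≡b)) → inj₂ u≡b })

empty⇒HasSize-0 : (∀ {u} → ¬ P u) → HasSize P 0
empty⇒HasSize-0 ¬P = [] , refl , [] , λ u → mk⇔ (⊥-elim ∘ ¬P) (λ ())

HasSize-0⇒empty : HasSize P 0 → ∀ {u} → ¬ P u
HasSize-0⇒empty ([] , _ , _ , mem) {u} Pu with () ← Equivalence.to (mem u) Pu

HasSize-inhabited : HasSize P n → 0 < n → ∃ P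
HasSize-inhabited ([]    , refl , _ , _)   ()
HasSize-inhabited (u ∷ _ , _    , _ , mem) _ = u , Equivalence.from (mem u) (here refl)

Fin-cardinality : Cardinality (Fin n) n
Fin-cardinality {n} = allFin n , List.length-tabulate id , Unique.allFin⁺ n , λ i → mk⇔ (λ _ → ∈-allFin i) (λ _ → tt)

↔-cardinality : Fin n ↔ A → Cardinality A n
↔-cardinality enum = HasSize-image to (Injection.injective (↔⇒↣ enum)) (λ _ → tt)
  (λ {a} _ → from a , tt , sym (strictlyInverseˡ a)) Fin-cardinality
  where open Inverse enum

module _ {A : Set} (_≟_ : DecidableEquality A) (hA : Cardinality A n) where
  open DecMembership _≟_ using (_∈?_)

  injective⇒surjective : (f : A → A) → (∀ {a a′} → f a ≡ f a′ → a ≡ a′) → ∀ b → ∃[ a ] f a ≡ b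
  injective⇒surjective f f-injective b with b ∈? map f (elements hA)
  ... | yes b∈image = let a , _ , b≡fa = ∈-map⁻ f b∈image in a , sym b≡fa
  ... | no  b∉image = ⊥-elim (ℕ.<-irrefl refl (begin-strict
      n                                  ≡⟨ length-elements hA ⟨
      length (elements hA)               ≡⟨ List.length-map f (elements hA) ⟨
      length (map f (elements hA))       <⟨ ℕ.n<1+n _ ⟩
      length (b ∷ map f (elements hA))   ≤⟨ length≤size hA (¬Any⇒All¬ _ b∉image ∷ Unique.map⁺ f-injective (unique-elements hA))
                                                            (All.universal _ _) ⟩
      n                                  ∎))
    where open ℕ.≤-Reasoning

  HasSize-preimage : (f : A → A) → (∀ {a a′} → f a ≡ f a′ → a ≡ a′) → HasSize P m → HasSize (P ∘ f) m
  HasSize-preimage {P = P} f f-injective = HasSize-image f⁻¹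
    (λ {b} {b′} eq → trans (sym (f∘f⁻¹ b)) (trans (cong f eq) (f∘f⁻¹ b′)))
    (λ {b} → subst P (sym (f∘f⁻¹ b)))
    (λ {a} Pfa → f a , Pfa , f-injective (sym (f∘f⁻¹ (f a))))
    where
    f⁻¹ : A → A
    f⁻¹ b = proj₁ (injective⇒surjective f f-injective b)
    f∘f⁻¹ : ∀ b → f (f⁻¹ b) ≡ b
    f∘f⁻¹ b = proj₂ (injective⇒surjective f f-injective b)

another : (i : Fin (suc (suc n))) → ∃[ j ] i ≢ j
another Fin.zero    = Fin.suc Fin.zero , λ ()
another (Fin.suc _) = Fin.zero , λ ()

third : 1 ≤ n → (i j : Fin (suc (suc n))) → ∃[ k ] i ≢ k × j ≢ k
third (s≤s z≤n) Fin.zero              Fin.zero              = Fin.suc Fin.zero , (λ ()) , (λ ())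
third (s≤s z≤n) Fin.zero              (Fin.suc Fin.zero)    = Fin.suc (Fin.suc Fin.zero) , (λ ()) , (λ ())
third (s≤s z≤n) Fin.zero              (Fin.suc (Fin.suc _)) = Fin.suc Fin.zero , (λ ()) , (λ ())
third (s≤s z≤n) (Fin.suc Fin.zero)    Fin.zero              = Fin.suc (Fin.suc Fin.zero) , (λ ()) , (λ ())
third (s≤s z≤n) (Fin.suc Fin.zero)    (Fin.suc _)           = Fin.zero , (λ ()) , (λ ())
third (s≤s z≤n) (Fin.suc (Fin.suc _)) Fin.zero              = Fin.suc Fin.zero , (λ ()) , (λ ())
third (s≤s z≤n) (Fin.suc (Fin.suc _)) (Fin.suc _)           = Fin.zero , (λ ()) , (λ ())

∑ : List A → (A → ℕ) → ℕ
∑ []       f = 0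
∑ (x ∷ xs) f = f x + ∑ xs f

infix 5 ∑
syntax ∑ xs (λ x → e) = ∑[ x ∈ xs ] e

indicator : {X : Set} → Dec X → ℕ
indicator (yes _) = 1
indicator (no _)  = 0

count : {P : A → Set} → Decidable P → List A → ℕ
count P? xs = ∑[ x ∈ xs ] indicator (P? x)

∑-cong : {xs : List A} {f g : A → ℕ} → (∀ {x} → x ∈ xs → f x ≡ g x) → ∑ xs f ≡ ∑ xs g
∑-cong {xs = []}     f≡g = refl
∑-cong {xs = x ∷ xs} f≡g = cong₂ _+_ (f≡g (here refl)) (∑-cong (f≡g ∘ there))

∑-zero : {xs : List A} {f : A → ℕ} → (∀ {x} → x ∈ xs → f x ≡ 0) → ∑ xs f ≡ 0
∑-zero {xs = []}     f≡0 = refl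
∑-zero {xs = x ∷ xs} f≡0 = cong₂ _+_ (f≡0 (here refl)) (∑-zero (f≡0 ∘ there))

∑-+ : (xs : List A) (f g : A → ℕ) → ∑[ x ∈ xs ] (f x + g x) ≡ ∑ xs f + ∑ xs g
∑-+ []       f g = refl
∑-+ (x ∷ xs) f g = trans (cong (f x + g x +_) (∑-+ xs f g)) (interchange (f x) (g x) (∑ xs f) (∑ xs g))
  where open import Algebra.Properties.CommutativeSemigroup ℕ.+-commutativeSemigroup using (interchange)

∑-*ˡ : (xs : List A) (k : ℕ) (f : A → ℕ) → ∑[ x ∈ xs ] (k * f x) ≡ k * ∑ xs f
∑-*ˡ []       k f = sym (ℕ.*-zeroʳ k)
∑-*ˡ (x ∷ xs) k f = trans (cong (k * f x +_) (∑-*ˡ xs k f)) (sym (ℕ.*-distribˡ-+ k (f x) _))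

∑-swap : (xs : List A) (ys : List B) (f : A → B → ℕ) →
  ∑[ x ∈ xs ] ∑[ y ∈ ys ] f x y ≡ ∑[ y ∈ ys ] ∑[ x ∈ xs ] f x y
∑-swap []       ys f = sym (∑-zero {xs = ys} (λ _ → refl))
∑-swap (x ∷ xs) ys f = trans (cong (∑ ys (f x) +_) (∑-swap xs ys f))
                             (sym (∑-+ ys (f x) (λ y → ∑[ x ∈ xs ] f x y)))

∑-indicator : {xs : List A} {f : A → ℕ} (Q? : Decidable Q) →
  (∀ {x} → x ∈ xs → f x ≡ k * indicator (Q? x)) → ∑ xs f ≡ k * count Q? xs
∑-indicator {k = k} {xs = xs} Q? f≡ = trans (∑-cong f≡) (∑-*ˡ xs k (indicator ∘ Q?))

indicator-× : {X Y : Set} (x? : Dec X) (y? : Dec Y) → indicator (x? ×-dec y?) ≡ indicator x? * indicator y?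
indicator-× (yes _) (yes _) = refl
indicator-× (yes _) (no _)  = refl
indicator-× (no _)  _       = refl

count-* : {P : A → Set} {Q : B → Set} (P? : Decidable P) (Q? : Decidable Q) (xs : List A) (ys : List B) →
  count P? xs * count Q? ys ≡ ∑[ x ∈ xs ] ∑[ y ∈ ys ] indicator (P? x ×-dec Q? y)
count-* P? Q? xs ys = begin
  count P? xs * count Q? ys                                     ≡⟨ ℕ.*-comm (count P? xs) _ ⟩
  count Q? ys * count P? xs                                     ≡⟨ ∑-*ˡ xs (count Q? ys) (indicator ∘ P?) ⟨
  ∑[ x ∈ xs ] count Q? ys * indicator (P? x)                    ≡⟨ ∑-cong {xs = xs} (λ {x} _ → ℕ.*-comm (count Q? ys) (indicator (P? x))) ⟩
  ∑[ x ∈ xs ] indicator (P? x) * count Q? ys                    ≡⟨ ∑-cong {xs = xs} (λ {x} _ → ∑-*ˡ ys (indicator (P? x)) (indicator ∘ Q?)) ⟨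
  ∑[ x ∈ xs ] ∑[ y ∈ ys ] indicator (P? x) * indicator (Q? y)   ≡⟨ ∑-cong {xs = xs} (λ {x} _ → ∑-cong {xs = ys} (λ {y} _ → indicator-× (P? x) (Q? y))) ⟨
  ∑[ x ∈ xs ] ∑[ y ∈ ys ] indicator (P? x ×-dec Q? y)           ∎
  where open ≡-Reasoning

length-filter : (Q? : Decidable Q) (xs : List A) → length (filter Q? xs) ≡ count Q? xs
length-filter Q? []       = refl
length-filter Q? (x ∷ xs) with Q? x
... | yes _ = cong suc (length-filter Q? xs)
... | no  _ = length-filter Q? xs

count-complement : (Q? : Decidable Q) (xs : List A) → count Q? xs + count (¬? ∘ Q?) xs ≡ length xs
count-complement Q? []       = refl
count-complement Q? (x ∷ xs) with Q? x
... | yes _ = cong suc (count-complement Q? xs)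
... | no  _ = trans (ℕ.+-suc _ _) (cong suc (count-complement Q? xs))

count-split : {Q : A → Set} (P? : Decidable P) (Q? : Decidable Q) (xs : List A) →
  count (λ x → P? x ×-dec Q? x) xs + count (λ x → ¬? (P? x) ×-dec Q? x) xs ≡ count Q? xs
count-split P? Q? []       = refl
count-split P? Q? (x ∷ xs) with P? x | Q? x
... | yes _ | yes _ = cong suc (count-split P? Q? xs)
... | yes _ | no  _ = count-split P? Q? xs
... | no  _ | yes _ = trans (ℕ.+-suc _ _) (cong suc (count-split P? Q? xs))
... | no  _ | no  _ = count-split P? Q? xs

module _ {P : A → Set} (hs : HasSize P n) where
  HasSize-count : (Q? : Decidable Q) → HasSize (λ u → P u × Q u) (count Q? (elements hs))
  HasSize-count Q? =
    filter Q? (elements hs) , length-filter Q? (elements hs) , Unique.filter⁺ Q? (unique-elements hs) , λ u → mk⇔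
      (λ (Pu , Qu) → ∈-filter⁺ Q? (∈-elements⁺ hs Pu) Qu)
      (λ u∈ → let u∈xs , Qu = ∈-filter⁻ Q? u∈ in ∈-elements⁻ hs u∈xs , Qu)

  count≡size : (Q? : Decidable Q) → HasSize (λ u → P u × Q u) k → count Q? (elements hs) ≡ k
  count≡size Q? = HasSize-unique (HasSize-count Q?)

  HasSize-complement : (Q? : Decidable Q) → HasSize (λ u → P u × Q u) k → HasSize (λ u → P u × ¬ Q u) (n ∸ k)
  HasSize-complement {k = k} Q? hk = subst (HasSize _) count¬Q≡n∸k (HasSize-count (¬? ∘ Q?))
    where
    count¬Q≡n∸k : count (¬? ∘ Q?) (elements hs) ≡ n ∸ k
    count¬Q≡n∸k = begin
      count (¬? ∘ Q?) (elements hs)                                ≡⟨ ℕ.m+n∸m≡n k _ ⟨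
      k + count (¬? ∘ Q?) (elements hs) ∸ k                        ≡⟨ cong (λ t → t + _ ∸ k) (count≡size Q? hk) ⟨
      count Q? (elements hs) + count (¬? ∘ Q?) (elements hs) ∸ k   ≡⟨ cong (_∸ k) (count-complement Q? (elements hs)) ⟩
      length (elements hs) ∸ k                                     ≡⟨ cong (_∸ k) (length-elements hs) ⟩
      n ∸ k                                                        ∎
      where open ≡-Reasoning

module _ {A : Set} (hA : Cardinality A m) where
  count-all : {Q : A → Set} (Q? : Decidable Q) → HasSize Q n → count Q? (elements hA) ≡ n
  count-all Q? hQ = count≡size hA Q? (HasSize-cong (tt ,_) proj₂ hQ)

  HasSize-¬ : {Q : A → Set} (Q? : Decidable Q) → HasSize Q k → HasSize (¬_ ∘ Q) (m ∸ k)
  HasSize-¬ Q? hQ = HasSize-cong proj₂ (tt ,_) (HasSize-complement hA Q? (HasSize-cong (tt ,_) proj₂ hQ))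

  avoid-two : DecidableEquality A → 3 ≤ m → (a b : A) → ∃[ c ] c ≢ a × c ≢ b
  avoid-two _≟_ 3≤m a b with a ≟ b
  ... | yes refl = let c , c≢a = HasSize-inhabited (HasSize-¬ (_≟ a) (HasSize-≡ a)) (ℕ.m<n⇒0<n∸m (ℕ.<-≤-trans (s≤s (s≤s z≤n)) 3≤m))
                   in c , c≢a , c≢a
  ... | no  a≢b  = let c , c∉ab = HasSize-inhabited (HasSize-¬ (λ c → (c ≟ a) ⊎-dec (c ≟ b)) (HasSize-pair a≢b)) (ℕ.m<n⇒0<n∸m 3≤m)
                   in c , c∉ab ∘ inj₁ , c∉ab ∘ inj₂

-- Arithmetic

ℓ : ℕ → ℕ
ℓ q = (q * (q ∸ 1)) / 2

c₃ : ℕ → ℕ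
c₃ q = ((q + 1) * q) / 4

m≡2n⇒m/2≡n : ∀ {m n} → 2 * n ≡ m → m / 2 ≡ n
m≡2n⇒m/2≡n {n = n} refl = trans (cong (_/ 2) (ℕ.*-comm 2 n)) (m*n/n≡m n 2)

m≡4n⇒m/4≡n : ∀ {m n} → 4 * n ≡ m → m / 4 ≡ n
m≡4n⇒m/4≡n {n = n} refl = trans (cong (_/ 4) (ℕ.*-comm 4 n)) (m*n/n≡m n 4)

[2a][2b]≡4[ab] : ∀ a b → 2 * a * (2 * b) ≡ 4 * (a * b)
[2a][2b]≡4[ab] = solve-∀

q[q-1]+q[q+1]≡2q² : ∀ q → q * (q ∸ 1) + q * suc q ≡ 2 * (q * q)
q[q-1]+q[q+1]≡2q² zero    = refl
q[q-1]+q[q+1]≡2q² (suc p) = identity p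
  where
  identity : ∀ p → suc p * p + suc p * suc (suc p) ≡ 2 * (suc p * suc p)
  identity = solve-∀

ℓ-arithmetic : ∀ {q a b} → 2 * b ≡ q * suc q → a + b ≡ q * q → a ≡ ℓ q
ℓ-arithmetic {q} {a} {b} 2b≡ a+b≡ = sym (m≡2n⇒m/2≡n (ℕ.+-cancelʳ-≡ (q * suc q) _ _ (begin
  2 * a + q * suc q        ≡⟨ cong (2 * a +_) 2b≡ ⟨
  2 * a + 2 * b            ≡⟨ ℕ.*-distribˡ-+ 2 a b ⟨
  2 * (a + b)              ≡⟨ cong (2 *_) a+b≡ ⟩
  2 * (q * q)              ≡⟨ q[q-1]+q[q+1]≡2q² q ⟨
  q * (q ∸ 1) + q * suc q  ∎)))
  where open ≡-Reasoning

half-arithmetic : ∀ {q a b} → 2 * b ≡ q → a + b ≡ q → a ≡ q / 2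
half-arithmetic {q} {a} {b} 2b≡q a+b≡q = sym (m≡2n⇒m/2≡n {q} (ℕ.+-cancelʳ-≡ (2 * b) _ _ (begin
  2 * a + 2 * b   ≡⟨ ℕ.*-distribˡ-+ 2 a b ⟨
  2 * (a + b)     ≡⟨ cong (2 *_) a+b≡q ⟩
  q + (q + 0)     ≡⟨ cong (q +_) (ℕ.+-identityʳ q) ⟩
  q + q           ≡⟨ cong (q +_) 2b≡q ⟨
  q + 2 * b       ∎)))
  where open ≡-Reasoning

c₃-arithmetic : ∀ {q a b c} → 4 * b ≡ q * suc q → 2 * c ≡ q * suc q → a + b ≡ c → a ≡ c₃ q
c₃-arithmetic {q} {a} {b} {c} 4b≡ 2c≡ a+b≡c = sym (m≡4n⇒m/4≡n {(q + 1) * q} (ℕ.+-cancelʳ-≡ (4 * b) _ _ (begin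
  4 * a + 4 * b              ≡⟨ ℕ.*-distribˡ-+ 4 a b ⟨
  4 * (a + b)                ≡⟨ cong (4 *_) a+b≡c ⟩
  4 * c                      ≡⟨ ℕ.*-assoc 2 2 c ⟩
  2 * (2 * c)                ≡⟨ cong (2 *_) 2c≡ ⟩
  2 * (q * suc q)            ≡⟨ identity q ⟩
  (q + 1) * q + q * suc q    ≡⟨ cong ((q + 1) * q +_) 4b≡ ⟨
  (q + 1) * q + 4 * b        ∎)))
  where
  identity : ∀ q → 2 * (q * suc q) ≡ (q + 1) * q + q * suc q
  identity = solve-∀
  open ≡-Reasoning

-- Coordinates from a dual hyperoval

module FiniteAffineSpace {q : ℕ} (F : FiniteField q) where
  open FiniteField F using (Carrier; 0≢1; enum)
  open Geometry F using (V3)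

  Carrier-cardinality : Cardinality Carrier q
  Carrier-cardinality = ↔-cardinality enum

  V3-cardinality : Cardinality V3 (q * (q * q))
  V3-cardinality = HasSize-cong _ _ (HasSize-× Carrier-cardinality (HasSize-× Carrier-cardinality Carrier-cardinality))

  2≤q : 2 ≤ q
  2≤q = length≤size Carrier-cardinality ((0≢1 ∷ []) ∷ [] ∷ []) (tt ∷ tt ∷ [])

module DualHyperoval {q : ℕ} (F : FiniteField q) (h : Fin (suc (suc q)) → Geometry.V3 F)
                     (hyp : Geometry.IsDualHyperoval F h) where
  open FiniteField F using (0#)
  open Geometry F
  open FieldAlgebra F
  open FiniteAffineSpace F

  classes : List (Fin (suc (suc q)))
  classes = allFin (suc (suc q))

  private
    through : ∀ {p w} → HasSize (λ j → h j · (w -v p) ≡ 0#) n → HasSize (λ j → h j · w ≡ h j · p) n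
    through {p = p} {w = w} = HasSize-cong (Equivalence.to (·-v≡0⇔ (h _) w p)) (Equivalence.from (·-v≡0⇔ (h _) w p))

  no-three-concurrent : ∀ {d i j k} → d ≢ 0v → i ≢ j → i ≢ k → j ≢ k →
    h i · d ≡ 0# → h j · d ≡ 0# → h k · d ≢ 0#
  no-three-concurrent {d} d≢0 i≢j i≢k j≢k hi·d hj·d hk·d =
    [ three≰ (λ ()) , three≰ (λ { (s≤s (s≤s ())) }) ]′ (proj₂ (proj₂ hyp) d d≢0)
    where
    three≰ : ¬ 3 ≤ n → HasSize (λ l → h l · d ≡ 0#) n → ⊥
    three≰ 3≰n hs = 3≰n (length≤size hs ((i≢j ∷ i≢k ∷ []) ∷ (j≢k ∷ []) ∷ [] ∷ []) (hi·d ∷ hj·d ∷ hk·d ∷ []))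

  module Coordinates {i j k : Fin (suc (suc q))} (i≢j : i ≢ j) (i≢k : i ≢ k) (j≢k : j ≢ k) where
    coordinates : V3 → V3
    coordinates w = h i · w , h j · w , h k · w

    coordinates-injective : ∀ {w w′} → coordinates w ≡ coordinates w′ → w ≡ w′
    coordinates-injective {w} {w′} eq with w -v w′ ≟V 0v
    ... | yes w-w′≡0 = -v≡0v⇒≡ w-w′≡0
    ... | no  w-w′≢0 = ⊥-elim (no-three-concurrent w-w′≢0 i≢j i≢k j≢k
                                 (on i (cong proj₁ eq)) (on j (cong (proj₁ ∘ proj₂) eq)) (on k (cong (proj₂ ∘ proj₂) eq)))
      where
      on : ∀ l → h l · w ≡ h l · w′ → h l · (w -v w′) ≡ 0#
      on l = Equivalence.from (·-v≡0⇔ (h l) w w′)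

    HasSize-coordinates : HasSize P n → HasSize (P ∘ coordinates) n
    HasSize-coordinates = HasSize-preimage _≟V_ V3-cardinality coordinates coordinates-injective

  -- Only the sizes matter; unfolding these proofs makes type checking run out of memory.
  abstract
    point-size : ∀ {i j k} → i ≢ j → i ≢ k → j ≢ k → ∀ α β γ →
      HasSize (λ w → h i · w ≡ α × h j · w ≡ β × h k · w ≡ γ) 1
    point-size i≢j i≢k j≢k α β γ = HasSize-coordinates (HasSize-× (HasSize-≡ α) (HasSize-× (HasSize-≡ β) (HasSize-≡ γ)))
      where open Coordinates i≢j i≢k j≢k

    line-size : ∀ {i j} → i ≢ j → ∀ α β → HasSize (λ w → h i · w ≡ α × h j · w ≡ β) q
    line-size {i} {j} i≢j α β with third (ℕ.<⇒≤ 2≤q) i j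
    ... | _ , i≢k , j≢k =
      subst (HasSize _) (trans (ℕ.*-identityˡ _) (ℕ.*-identityˡ q))
        (HasSize-cong (λ (on-i , on-j , _) → on-i , on-j) (λ (on-i , on-j) → on-i , on-j , tt)
          (HasSize-coordinates (HasSize-× (HasSize-≡ α) (HasSize-× (HasSize-≡ β) Carrier-cardinality))))
      where open Coordinates i≢j i≢k j≢k

    plane-size : ∀ i α → HasSize (λ w → h i · w ≡ α) (q * q)
    plane-size i α with another i
    ... | j , i≢j with third (ℕ.<⇒≤ 2≤q) i j
    ... | _ , i≢k , j≢k =
      subst (HasSize _) (ℕ.*-identityˡ (q * q))
        (HasSize-cong proj₁ (λ on-i → on-i , tt , tt)
          (HasSize-coordinates (HasSize-× (HasSize-≡ α) (HasSize-× Carrier-cardinality Carrier-cardinality))))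
      where open Coordinates i≢j i≢k j≢k

  on-plane≢off-plane : ∀ {i c w p} → h i · w ≡ c → h i · p ≢ c → w ≢ p
  on-plane≢off-plane on off refl = off on

  #other-classes : ∀ i → count (λ j → ¬? (j Fin.≟ i)) (classes) ≡ suc q
  #other-classes i = count-all Fin-cardinality (λ j → ¬? (j Fin.≟ i)) (HasSize-¬ Fin-cardinality (Fin._≟ i) (HasSize-≡ i))

  #classes-avoiding : ∀ {i j} → i ≢ j → count (λ k → ¬? ((k Fin.≟ i) ⊎-dec (k Fin.≟ j))) (classes) ≡ q
  #classes-avoiding {i} {j} i≢j = count-all Fin-cardinality (λ k → ¬? ((k Fin.≟ i) ⊎-dec (k Fin.≟ j)))
    (HasSize-¬ Fin-cardinality (λ k → (k Fin.≟ i) ⊎-dec (k Fin.≟ j)) (HasSize-pair i≢j))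

  -- The direction w − p lies on no line of H*: the line pw meets π in an exterior point.
  ExteriorJoin : V3 → V3 → Set
  ExteriorJoin p w = ∀ j → h j · w ≢ h j · p

  abstract
    ExteriorJoin? : ∀ p → Decidable (ExteriorJoin p)
    ExteriorJoin? p w = all? (λ j → ¬? (h j · w ≟F h j · p))

  common? : ∀ p j w → Dec (h j · w ≡ h j · p)
  common? p j w = h j · w ≟F h j · p

  #common-classes : V3 → V3 → ℕ
  #common-classes p w = count (λ j → common? p j w) (classes)

  abstract
    common-classes : ∀ {p w} → w ≢ p → ¬ ExteriorJoin p w → HasSize (λ j → h j · w ≡ h j · p) 2
    common-classes {p} {w} w≢p ¬ext with proj₂ (proj₂ hyp) (w -v p) (w≢p ∘ -v≡0v⇒≡)
    ... | inj₁ none = ⊥-elim (¬ext (λ _ → HasSize-0⇒empty (through none)))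
    ... | inj₂ two  = through two

  #common-classes≡ : ∀ {p w} → w ≢ p → #common-classes p w ≡ 2 * indicator (¬? (ExteriorJoin? p w))
  #common-classes≡ {p} {w} w≢p with ExteriorJoin? p w
  ... | yes ext  = count-all Fin-cardinality (λ j → common? p j w) (empty⇒HasSize-0 (ext _))
  ... | no  ¬ext = count-all Fin-cardinality (λ j → common? p j w) (common-classes w≢p ¬ext)

  2*#non-exterior≡∑ : ∀ {p} {P : V3 → Set} (S : HasSize P n) → (∀ {w} → P w → w ≢ p) →
    2 * count (¬? ∘ ExteriorJoin? p) (elements S) ≡ ∑[ j ∈ classes ] count (common? p j) (elements S)
  2*#non-exterior≡∑ {p = p} S S∌p = begin
    2 * count (¬? ∘ ExteriorJoin? p) (elements S)  ≡⟨ ∑-indicator {k = 2} (¬? ∘ ExteriorJoin? p) (#common-classes≡ ∘ S∌p ∘ ∈-elements⁻ S) ⟨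
    ∑[ w ∈ elements S ] #common-classes p w        ≡⟨ ∑-swap (elements S) (classes) (λ w j → indicator (common? p j w)) ⟩
    ∑[ j ∈ classes ] count (common? p j) (elements S) ∎
    where open ≡-Reasoning

  module _ {p i c} (p∉plane : h i · p ≢ c) where
    private
      plane = plane-size i c

      common-on-plane : ∀ {j} → j ∈ classes → count (common? p j) (elements plane) ≡ q * indicator (¬? (j Fin.≟ i))
      common-on-plane {j} _ with j Fin.≟ i
      ... | yes refl = trans (count≡size plane (common? p j) (empty⇒HasSize-0 λ (on , e) → p∉plane (trans (sym e) on)))
                             (sym (ℕ.*-zeroʳ q))
      ... | no  j≢i  = trans (count≡size plane (common? p j) (line-size (j≢i ∘ sym) c (h j · p))) (sym (ℕ.*-identityʳ q))

    2*#non-exterior-on-plane : 2 * count (¬? ∘ ExteriorJoin? p) (elements plane) ≡ q * suc q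
    2*#non-exterior-on-plane = begin
      2 * count (¬? ∘ ExteriorJoin? p) (elements plane)      ≡⟨ 2*#non-exterior≡∑ plane (λ on → on-plane≢off-plane on p∉plane) ⟩
      ∑[ j ∈ classes ] count (common? p j) (elements plane) ≡⟨ ∑-indicator {k = q} (λ j → ¬? (j Fin.≟ i)) common-on-plane ⟩
      q * count (λ j → ¬? (j Fin.≟ i)) (classes)           ≡⟨ cong (q *_) (#other-classes i) ⟩
      q * suc q                                              ∎
      where open ≡-Reasoning

    abstract
      exterior-on-plane : HasSize (λ w → h i · w ≡ c × ExteriorJoin p w) (ℓ q)
      exterior-on-plane = subst (HasSize _)
        (ℓ-arithmetic {q} 2*#non-exterior-on-plane (trans (count-complement (ExteriorJoin? p) (elements plane)) (length-elements plane)))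
        (HasSize-count plane (ExteriorJoin? p))

  module _ {p i j c f} (i≢j : i ≢ j) (p∉plane₁ : h i · p ≢ c) (p∉plane₂ : h j · p ≢ f) where
    private
      line = line-size i≢j c f

      common-on-line : ∀ {k} → k ∈ classes →
        count (common? p k) (elements line) ≡ 1 * indicator (¬? ((k Fin.≟ i) ⊎-dec (k Fin.≟ j)))
      common-on-line {k} _ with k Fin.≟ i | k Fin.≟ j
      ... | yes refl | _        = count≡size line (common? p k) (empty⇒HasSize-0 λ ((on , _) , e) → p∉plane₁ (trans (sym e) on))
      ... | no _     | yes refl = count≡size line (common? p k) (empty⇒HasSize-0 λ ((_ , on) , e) → p∉plane₂ (trans (sym e) on))
      ... | no k≢i   | no k≢j   = count≡size line (common? p k)
        (HasSize-cong (λ (e₁ , e₂ , e₃) → (e₁ , e₂) , e₃) (λ ((e₁ , e₂) , e₃) → e₁ , e₂ , e₃) (point-size i≢j (k≢i ∘ sym) (k≢j ∘ sym) c f (h k · p)))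

      2*#non-exterior-on-line : 2 * count (¬? ∘ ExteriorJoin? p) (elements line) ≡ q
      2*#non-exterior-on-line = begin
        2 * count (¬? ∘ ExteriorJoin? p) (elements line)                 ≡⟨ 2*#non-exterior≡∑ line (λ (on , _) → on-plane≢off-plane on p∉plane₁) ⟩
        ∑[ k ∈ classes ] count (common? p k) (elements line)            ≡⟨ ∑-indicator {k = 1} (λ k → ¬? ((k Fin.≟ i) ⊎-dec (k Fin.≟ j))) common-on-line ⟩
        1 * count (λ k → ¬? ((k Fin.≟ i) ⊎-dec (k Fin.≟ j))) (classes) ≡⟨ ℕ.*-identityˡ _ ⟩
        count (λ k → ¬? ((k Fin.≟ i) ⊎-dec (k Fin.≟ j))) (classes)     ≡⟨ #classes-avoiding i≢j ⟩
        q                                                                ∎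
        where open ≡-Reasoning

    abstract
      exterior-on-line : HasSize (λ w → (h i · w ≡ c × h j · w ≡ f) × ExteriorJoin p w) (q / 2)
      exterior-on-line = subst (HasSize _)
        (half-arithmetic {q} 2*#non-exterior-on-line (trans (count-complement (ExteriorJoin? p) (elements line)) (length-elements line)))
        (HasSize-count line (ExteriorJoin? p))

  module _ {x y i c} (xy-exterior : ExteriorJoin x y) (x∉plane : h i · x ≢ c) (y∉plane : h i · y ≢ c) where
    private
      plane = plane-size i c

      common-on-point : ∀ {j k} → j ≢ i → k ∈ classes →
        count (λ w → common? x j w ×-dec common? y k w) (elements plane) ≡ 1 * indicator (¬? ((k Fin.≟ i) ⊎-dec (k Fin.≟ j)))
      common-on-point {j} {k} j≢i _ with k Fin.≟ i | k Fin.≟ j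
      ... | yes refl | _        = count≡size plane (λ w → common? x j w ×-dec common? y k w)
                                    (empty⇒HasSize-0 λ (on , _ , e) → y∉plane (trans (sym e) on))
      ... | no _     | yes refl = count≡size plane (λ w → common? x j w ×-dec common? y k w)
                                    (empty⇒HasSize-0 λ (_ , e₁ , e₂) → xy-exterior k (trans (sym e₂) e₁))
      ... | no k≢i   | no k≢j   = count≡size plane (λ w → common? x j w ×-dec common? y k w)
                                    (point-size (j≢i ∘ sym) (k≢i ∘ sym) (k≢j ∘ sym) c (h j · x) (h k · y))

      common-pairs : ∀ {j} → j ∈ classes →
        ∑[ k ∈ classes ] count (λ w → common? x j w ×-dec common? y k w) (elements plane) ≡ q * indicator (¬? (j Fin.≟ i))
      common-pairs {j} _ with j Fin.≟ i
      ... | yes refl = trans (∑-zero {xs = classes} λ {k} _ →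
                               count≡size plane (λ w → common? x j w ×-dec common? y k w)
                                 (empty⇒HasSize-0 λ (on , e , _) → x∉plane (trans (sym e) on)))
                             (sym (ℕ.*-zeroʳ q))
      ... | no  j≢i  = begin
        ∑[ k ∈ classes ] count (λ w → common? x j w ×-dec common? y k w) (elements plane)
          ≡⟨ ∑-indicator {k = 1} (λ k → ¬? ((k Fin.≟ i) ⊎-dec (k Fin.≟ j))) (common-on-point j≢i) ⟩
        1 * count (λ k → ¬? ((k Fin.≟ i) ⊎-dec (k Fin.≟ j))) classes
          ≡⟨ trans (ℕ.*-identityˡ _) (#classes-avoiding (j≢i ∘ sym)) ⟩
        q
          ≡⟨ ℕ.*-identityʳ q ⟨
        q * 1 ∎
        where open ≡-Reasoning

      product-of-common : ∀ {w} → w ∈ elements plane →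
        #common-classes x w * #common-classes y w ≡ 4 * indicator (¬? (ExteriorJoin? x w) ×-dec ¬? (ExteriorJoin? y w))
      product-of-common {w} w∈plane = begin
        #common-classes x w * #common-classes y w
          ≡⟨ cong₂ _*_ (#common-classes≡ (on-plane≢off-plane on x∉plane)) (#common-classes≡ (on-plane≢off-plane on y∉plane)) ⟩
        2 * indicator (¬? (ExteriorJoin? x w)) * (2 * indicator (¬? (ExteriorJoin? y w)))
          ≡⟨ [2a][2b]≡4[ab] (indicator (¬? (ExteriorJoin? x w))) (indicator (¬? (ExteriorJoin? y w))) ⟩
        4 * (indicator (¬? (ExteriorJoin? x w)) * indicator (¬? (ExteriorJoin? y w)))
          ≡⟨ cong (4 *_) (indicator-× (¬? (ExteriorJoin? x w)) (¬? (ExteriorJoin? y w))) ⟨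
        4 * indicator (¬? (ExteriorJoin? x w) ×-dec ¬? (ExteriorJoin? y w)) ∎
        where
        open ≡-Reasoning
        on = ∈-elements⁻ plane w∈plane

      4*#non-exterior-to-both : 4 * count (λ w → ¬? (ExteriorJoin? x w) ×-dec ¬? (ExteriorJoin? y w)) (elements plane) ≡ q * suc q
      4*#non-exterior-to-both = begin
        4 * count (λ w → ¬? (ExteriorJoin? x w) ×-dec ¬? (ExteriorJoin? y w)) (elements plane)
          ≡⟨ ∑-indicator {k = 4} (λ w → ¬? (ExteriorJoin? x w) ×-dec ¬? (ExteriorJoin? y w)) product-of-common ⟨
        ∑[ w ∈ elements plane ] #common-classes x w * #common-classes y w
          ≡⟨ ∑-cong {xs = elements plane} (λ {w} _ → count-* (λ j → common? x j w) (λ k → common? y k w) classes classes) ⟩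
        ∑[ w ∈ elements plane ] ∑[ j ∈ classes ] ∑[ k ∈ classes ] indicator (common? x j w ×-dec common? y k w)
          ≡⟨ ∑-swap (elements plane) classes (λ w j → ∑[ k ∈ classes ] indicator (common? x j w ×-dec common? y k w)) ⟩
        ∑[ j ∈ classes ] ∑[ w ∈ elements plane ] ∑[ k ∈ classes ] indicator (common? x j w ×-dec common? y k w)
          ≡⟨ ∑-cong {xs = classes} (λ {j} _ → ∑-swap (elements plane) classes (λ w k → indicator (common? x j w ×-dec common? y k w))) ⟩
        ∑[ j ∈ classes ] ∑[ k ∈ classes ] count (λ w → common? x j w ×-dec common? y k w) (elements plane)
          ≡⟨ ∑-indicator {k = q} (λ j → ¬? (j Fin.≟ i)) common-pairs ⟩
        q * count (λ j → ¬? (j Fin.≟ i)) classes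
          ≡⟨ cong (q *_) (#other-classes i) ⟩
        q * suc q ∎
        where open ≡-Reasoning

    abstract
      exterior-to-x-not-y : HasSize (λ w → (h i · w ≡ c × ExteriorJoin x w) × ¬ ExteriorJoin y w) (c₃ q)
      exterior-to-x-not-y = HasSize-cong (λ (on , ext , ¬ext) → (on , ext) , ¬ext) (λ ((on , ext) , ¬ext) → on , ext , ¬ext)
        (subst (HasSize _)
          (c₃-arithmetic {q} 4*#non-exterior-to-both (2*#non-exterior-on-plane y∉plane)
            (count-split (ExteriorJoin? x) (¬? ∘ ExteriorJoin? y) (elements plane)))
          (HasSize-count plane (λ w → ExteriorJoin? x w ×-dec ¬? (ExteriorJoin? y w))))

      exterior-to-both : HasSize (λ w → (h i · w ≡ c × ExteriorJoin x w) × ExteriorJoin y w) (ℓ q ∸ c₃ q)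
      exterior-to-both = HasSize-cong (λ { {w} (on-ext , ¬¬ext) → on-ext , decidable-stable (ExteriorJoin? y w) ¬¬ext })
                                      (λ (on-ext , ext) → on-ext , λ ¬ext → ¬ext ext)
        (HasSize-complement (exterior-on-plane x∉plane) (¬? ∘ ExteriorJoin? y) exterior-to-x-not-y)

-- Distances in bipartite graphs

module DistanceLabelling (G : BipartiteGraph) where
  open BipartiteGraph G
  open BG G renaming (A to Vertex)

  adjacent-vertex : ∀ {u w} → Adj u w → Vtx w
  adjacent-vertex {inj₁ _} {inj₂ _} (_ , Zw , _) = Zw
  adjacent-vertex {inj₂ _} {inj₁ _} (Yw , _ , _) = Yw

  walk-end : ∀ {a w n} → Vtx a → Walk a w n → Vtx w
  walk-end Va nil           = Va
  walk-end _  (cons e walk) = walk-end (adjacent-vertex e) walk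

  snoc : ∀ {a u w n} → Walk a u n → Adj u w → Walk a w (suc n)
  snoc nil           e′ = cons e′ nil
  snoc (cons e walk) e′ = cons e (snoc walk e′)

  -- A labelling that vanishes at a, grows by at most one along edges and is attained by walks
  -- is the distance from a.
  module _ {a : Vertex} (Va : Vtx a) (δ : Vertex → ℕ) (δ-root : δ a ≡ 0)
           (δ-adjacent : ∀ {u w} → Adj u w → δ w ≤ suc (δ u))
           (walk : ∀ {w} → Vtx w → Walk a w (δ w)) where

    δ≤δ+length : ∀ {u w n} → Walk u w n → δ w ≤ δ u + n
    δ≤δ+length {u} nil = ℕ.m≤m+n (δ u) 0
    δ≤δ+length {u} {w} {suc n} (cons {b = b} e walk) = begin
      δ w             ≤⟨ δ≤δ+length walk ⟩
      δ b + n         ≤⟨ ℕ.+-monoˡ-≤ n (δ-adjacent e) ⟩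
      suc (δ u) + n   ≡⟨ ℕ.+-suc (δ u) n ⟨
      δ u + suc n     ∎
      where open ℕ.≤-Reasoning

    δ≤length : ∀ {w n} → Walk a w n → δ w ≤ n
    δ≤length {w} {n} walk-n = subst (λ d → δ w ≤ d + n) δ-root (δ≤δ+length walk-n)

    Dist⇒δ : ∀ {w i} → Dist a w i → δ w ≡ i
    Dist⇒δ {w} (walk-i , shortest) with ℕ.m≤n⇒m<n∨m≡n (δ≤length walk-i)
    ... | inj₁ δw<i = ⊥-elim (shortest (δ w) δw<i (walk (walk-end Va walk-i)))
    ... | inj₂ δw≡i = δw≡i

    δ⇒Dist : ∀ {w i} → Vtx w → δ w ≡ i → Dist a w i
    δ⇒Dist Vw refl = walk Vw , λ j j<δw walk-j → ℕ.<⇒≱ j<δw (δ≤length walk-j)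

    regular : (c b : ℕ → ℕ) →
      (∀ {w} → Vtx w → HasSize (λ u → Adj w u × δ u ≡ δ w ∸ 1) (c (δ w))
                     × HasSize (λ u → Adj w u × δ u ≡ suc (δ w)) (b (δ w))) →
      Regular a c b
    regular c b counts i w dist with refl ← Dist⇒δ dist =
      let c-count , b-count = counts (walk-end Va (proj₁ dist)) in
      HasSize-cong (λ (e , δu) → e , δ⇒Dist (adjacent-vertex e) δu) (λ (e , du) → e , Dist⇒δ du) c-count ,
      HasSize-cong (λ (e , δu) → e , δ⇒Dist (adjacent-vertex e) δu) (λ (e , du) → e , Dist⇒δ du) b-count

    eccentricity : ∀ d → (∀ {w} → Vtx w → δ w ≤ d) → (∃[ w ] Vtx w × δ w ≡ d) → Eccentricity a d
    eccentricity d δ≤d (w , Vw , δw≡d) = (λ u Vu → δ u , δ≤d Vu , δ⇒Dist Vu refl) , w , Vw , δ⇒Dist Vw δw≡d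

-- The incidence graph

cY bY cZ bZ : ℕ → ℕ → ℕ
cY q 1 = 1
cY q 2 = 2
cY q 3 = c₃ q
cY q 4 = q + 2
cY q _ = 0
bY q 0 = q + 2
bY q 1 = ℓ q ∸ 1
bY q 2 = q
bY q 3 = ℓ q ∸ c₃ q
bY q _ = 0
cZ q 1 = 1
cZ q 2 = q / 2
cZ q 3 = q + 1
cZ q 4 = ℓ q
cZ q _ = 0
bZ q 0 = ℓ q
bZ q 1 = q + 1
bZ q 2 = ℓ q ∸ q / 2
bZ q 3 = 1
bZ q _ = 0

module PlaneGraph {q : ℕ} (F : FiniteField q) (x : Geometry.V3 F) (h : Fin (suc (suc q)) → Geometry.V3 F)
                  (hyp : Geometry.IsDualHyperoval F h)
                  (3≤q : 3 ≤ q) (0<q/2 : 0 < q / 2) (0<c₃ : 0 < c₃ q) (c₃<ℓ : c₃ q < ℓ q) where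
  open Geometry F
  open FieldAlgebra F
  open FiniteAffineSpace F
  open DualHyperoval F h hyp
  open BipartiteGraph (planeGraph F x h)
  open BG (planeGraph F x h) renaming (A to Vertex)
  open DistanceLabelling (planeGraph F x h)
  open Equivalence using (to; from)

  InY⇔ExteriorJoin : ∀ {w} → InY w ⇔ ExteriorJoin x w
  InY⇔ExteriorJoin {w} = mk⇔
    (λ (_ , ext) j e → ext j (from (·-v≡0⇔ (h j) w x) e))
    (λ ext → (λ { refl → ext Fin.zero refl }) , λ j e → ext j (to (·-v≡0⇔ (h j) w x) e))

  all-classes : HasSize (λ (_ : Fin (suc (suc q))) → ⊤) (q + 2)
  all-classes = subst (HasSize _) (ℕ.+-comm 2 q) Fin-cardinality

  other-classes : ∀ i → HasSize (λ j → ¬ j ≡ i) (q + 1)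
  other-classes i = subst (HasSize _) (ℕ.+-comm 1 q) (HasSize-¬ (Fin-cardinality {suc (suc q)}) (Fin._≟ i) (HasSize-≡ i))

  neighbours-of-point : ∀ {w} → InY w → {R : Vertex → Set} {Q : Fin (suc (suc q)) → Set} →
    (∀ {j} → R (inj₂ (j , h j · w)) ⇔ Q j) → HasSize Q n → HasSize (λ u → Adj (inj₁ w) u × R u) n
  neighbours-of-point {w = w} Yw R⇔Q = HasSize-image (λ j → inj₂ (j , h j · w)) (cong proj₁ ∘ inj₂-injective)
    (λ Qj → (Yw , (λ e → to InY⇔ExteriorJoin Yw _ (sym e)) , refl) , from R⇔Q Qj)
    (λ { {inj₁ _} (() , _) ; {inj₂ (j , _)} ((_ , _ , refl) , Ru) → j , to R⇔Q Ru , refl })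

  neighbours-of-plane : ∀ {i c} → InZ (i , c) → {R : Vertex → Set} {Q : V3 → Set} →
    (∀ {w} → h i · w ≡ c → ExteriorJoin x w → R (inj₁ w) ⇔ Q w) →
    HasSize (λ w → (h i · w ≡ c × ExteriorJoin x w) × Q w) n → HasSize (λ u → Adj (inj₂ (i , c)) u × R u) n
  neighbours-of-plane Zic R⇔Q = HasSize-image inj₁ inj₁-injective
    (λ ((on , ext) , Qw) → (from InY⇔ExteriorJoin ext , Zic , on) , from (R⇔Q on ext) Qw)
    (λ { {inj₁ w} ((Yw , _ , on) , Rw) → let ext = to InY⇔ExteriorJoin Yw in w , ((on , ext) , to (R⇔Q on ext) Rw) , refl
       ; {inj₂ _} (() , _) })

  module FromPoint {y} (Yy : InY y) where
    private
      xy-exterior : ExteriorJoin x y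
      xy-exterior = to InY⇔ExteriorJoin Yy

    δ : Vertex → ℕ
    δ (inj₁ w) with w ≟V y | ExteriorJoin? y w
    ... | yes _ | _     = 0
    ... | no  _ | yes _ = 4
    ... | no  _ | no  _ = 2
    δ (inj₂ (j , f)) with f ≟F h j · y
    ... | yes _ = 1
    ... | no  _ = 3

    δ-root : δ (inj₁ y) ≡ 0
    δ-root with y ≟V y
    ... | yes _   = refl
    ... | no  y≢y = ⊥-elim (y≢y refl)

    δ-point≡0⇔ : ∀ {w} → δ (inj₁ w) ≡ 0 ⇔ w ≡ y
    δ-point≡0⇔ {w} with w ≟V y | ExteriorJoin? y w
    ... | yes w≡y | _     = mk⇔ (λ _ → w≡y) (λ _ → refl)
    ... | no  w≢y | yes _ = mk⇔ (λ ()) (⊥-elim ∘ w≢y)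
    ... | no  w≢y | no  _ = mk⇔ (λ ()) (⊥-elim ∘ w≢y)

    δ-near≡2⇔ : ∀ {w} → ¬ ExteriorJoin y w → δ (inj₁ w) ≡ 2 ⇔ w ≢ y
    δ-near≡2⇔ {w} ¬ext with w ≟V y | ExteriorJoin? y w
    ... | yes w≡y | _       = mk⇔ (λ ()) (λ w≢y → ⊥-elim (w≢y w≡y))
    ... | no  _   | yes ext = ⊥-elim (¬ext ext)
    ... | no  w≢y | no  _   = mk⇔ (λ _ → w≢y) (λ _ → refl)

    δ-off-root≡2⇔ : ∀ {w} → w ≢ y → δ (inj₁ w) ≡ 2 ⇔ (¬ ExteriorJoin y w)
    δ-off-root≡2⇔ {w} w≢y with w ≟V y | ExteriorJoin? y w
    ... | yes w≡y | _        = ⊥-elim (w≢y w≡y)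
    ... | no  _   | yes ext  = mk⇔ (λ ()) (λ ¬ext → ⊥-elim (¬ext ext))
    ... | no  _   | no  ¬ext = mk⇔ (λ _ → ¬ext) (λ _ → refl)

    δ-point≡4⇔ : ∀ {w} → δ (inj₁ w) ≡ 4 ⇔ ExteriorJoin y w
    δ-point≡4⇔ {w} with w ≟V y | ExteriorJoin? y w
    ... | yes refl | _        = mk⇔ (λ ()) (λ ext → ⊥-elim (ext Fin.zero refl))
    ... | no  _    | yes ext  = mk⇔ (λ _ → ext) (λ _ → refl)
    ... | no  _    | no  ¬ext = mk⇔ (λ ()) (⊥-elim ∘ ¬ext)

    δ-point≤4 : ∀ {w} → δ (inj₁ w) ≤ 4
    δ-point≤4 {w} with w ≟V y | ExteriorJoin? y w
    ... | yes _ | _     = z≤n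
    ... | no  _ | yes _ = ℕ.≤-refl
    ... | no  _ | no  _ = s≤s (s≤s z≤n)

    δ-point≤2 : ∀ {w} → ¬ ExteriorJoin y w → δ (inj₁ w) ≤ 2
    δ-point≤2 {w} ¬ext with w ≟V y | ExteriorJoin? y w
    ... | yes _ | _       = z≤n
    ... | no  _ | yes ext = ⊥-elim (¬ext ext)
    ... | no  _ | no  _   = ℕ.≤-refl

    δ-plane≡1⇔ : ∀ {j f} → δ (inj₂ (j , f)) ≡ 1 ⇔ f ≡ h j · y
    δ-plane≡1⇔ {j} {f} with f ≟F h j · y
    ... | yes on  = mk⇔ (λ _ → on) (λ _ → refl)
    ... | no  off = mk⇔ (λ ()) (⊥-elim ∘ off)

    δ-plane≡3⇔ : ∀ {j f} → δ (inj₂ (j , f)) ≡ 3 ⇔ f ≢ h j · y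
    δ-plane≡3⇔ {j} {f} with f ≟F h j · y
    ... | yes on  = mk⇔ (λ ()) (λ off → ⊥-elim (off on))
    ... | no  off = mk⇔ (λ _ → off) (λ _ → refl)

    δ-plane≢0 : ∀ {z} → δ (inj₂ z) ≢ 0
    δ-plane≢0 {j , f} with f ≟F h j · y
    ... | yes _ = λ ()
    ... | no  _ = λ ()

    δ-plane≢5 : ∀ {z} → δ (inj₂ z) ≢ 5
    δ-plane≢5 {j , f} with f ≟F h j · y
    ... | yes _ = λ ()
    ... | no  _ = λ ()

    δ-plane≤3 : ∀ {z} → δ (inj₂ z) ≤ 3
    δ-plane≤3 {j , f} with f ≟F h j · y
    ... | yes _ = s≤s z≤n
    ... | no  _ = ℕ.≤-refl

    δ-adjacent : ∀ {u v} → Adj u v → δ v ≤ suc (δ u)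
    δ-adjacent {inj₁ w} {inj₂ (j , f)} (_ , _ , on) with w ≟V y | ExteriorJoin? y w
    ... | yes refl | _     = ℕ.≤-reflexive (from δ-plane≡1⇔ (sym on))
    ... | no  _    | yes _ = ℕ.≤-trans δ-plane≤3 (ℕ.m≤n⇒m≤1+n (ℕ.n≤1+n 3))
    ... | no  _    | no  _ = δ-plane≤3
    δ-adjacent {inj₂ (j , f)} {inj₁ w} (_ , _ , on) with f ≟F h j · y
    ... | yes refl = δ-point≤2 (λ ext → ext j on)
    ... | no  _    = δ-point≤4

    walk-near : ∀ {w j} → InY w → h j · w ≡ h j · y → Walk (inj₁ y) (inj₁ w) 2
    walk-near {j = j} Yw common = cons {b = inj₂ (j , h j · y)} (Yy , Zj , refl) (cons (Yw , Zj , common) nil)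
      where Zj = λ e → xy-exterior j (sym e)

    walk-plane : ∀ {j f} → InZ (j , f) → f ≢ h j · y → Walk (inj₁ y) (inj₂ (j , f)) 3
    walk-plane Zjf f≢ =
      let w , (on , ext) , ¬ext = HasSize-inhabited (exterior-to-x-not-y xy-exterior Zjf (f≢ ∘ sym)) 0<c₃
          _ , common = HasSize-inhabited (common-classes (on-plane≢off-plane on (f≢ ∘ sym)) ¬ext) (s≤s z≤n)
          Yw = from InY⇔ExteriorJoin ext
      in snoc (walk-near Yw common) (Yw , Zjf , on)

    walk-far : ∀ {w} → InY w → ExteriorJoin y w → Walk (inj₁ y) (inj₁ w) 4
    walk-far {w} Yw ext = snoc (walk-plane Z₀ (ext Fin.zero)) (Yw , Z₀ , refl)
      where Z₀ = λ e → to InY⇔ExteriorJoin Yw Fin.zero (sym e)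

    walk : ∀ {u} → Vtx u → Walk (inj₁ y) u (δ u)
    walk {inj₁ w} Yw with w ≟V y | ExteriorJoin? y w
    ... | yes refl | _        = nil
    ... | no  _    | yes ext  = walk-far Yw ext
    ... | no  w≢y  | no  ¬ext = walk-near Yw (proj₂ (HasSize-inhabited (common-classes w≢y ¬ext) (s≤s z≤n)))
    walk {inj₂ (j , f)} Zjf with f ≟F h j · y
    ... | yes refl = cons (Yy , Zjf , refl) nil
    ... | no  f≢   = walk-plane Zjf f≢

    δ≤4 : ∀ {u} → δ u ≤ 4
    δ≤4 {inj₁ _} = δ-point≤4
    δ≤4 {inj₂ _} = ℕ.m≤n⇒m≤1+n δ-plane≤3

    counts : ∀ {u} → Vtx u → HasSize (λ v → Adj u v × δ v ≡ δ u ∸ 1) (cY q (δ u))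
                           × HasSize (λ v → Adj u v × δ v ≡ suc (δ u)) (bY q (δ u))
    counts {inj₁ w} Yw with w ≟V y | ExteriorJoin? y w
    ... | yes refl | _ =
      neighbours-of-point Yy (mk⇔ δ-plane≢0 ⊥-elim) (empty⇒HasSize-0 id) ,
      neighbours-of-point Yy (mk⇔ (λ _ → tt) (λ _ → from δ-plane≡1⇔ refl)) all-classes
    ... | no _ | yes ext =
      neighbours-of-point Yw (mk⇔ (λ _ → tt) (λ _ → from δ-plane≡3⇔ (ext _))) all-classes ,
      neighbours-of-point Yw (mk⇔ δ-plane≢5 ⊥-elim) (empty⇒HasSize-0 id)
    ... | no w≢y | no ¬ext =
      neighbours-of-point Yw δ-plane≡1⇔ (common-classes w≢y ¬ext) ,
      neighbours-of-point Yw δ-plane≡3⇔ (HasSize-¬ Fin-cardinality (λ j → common? y j w) (common-classes w≢y ¬ext))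
    counts {inj₂ (j , f)} Zjf with f ≟F h j · y
    ... | yes refl =
      neighbours-of-plane Zjf (λ _ _ → δ-point≡0⇔) just-y ,
      neighbours-of-plane Zjf (λ on _ → δ-near≡2⇔ (λ ext → ext j on)) (HasSize-complement (exterior-on-plane Zjf) (_≟V y) just-y)
      where
      just-y : HasSize (λ w → (h j · w ≡ h j · y × ExteriorJoin x w) × w ≡ y) 1
      just-y = HasSize-cong (λ { {_} refl → (refl , xy-exterior) , refl }) proj₂ (HasSize-≡ y)
    ... | no f≢ =
      neighbours-of-plane Zjf (λ on _ → δ-off-root≡2⇔ (on-plane≢off-plane on (f≢ ∘ sym))) (exterior-to-x-not-y xy-exterior Zjf (f≢ ∘ sym)) ,
      neighbours-of-plane Zjf (λ _ _ → δ-point≡4⇔) (exterior-to-both xy-exterior Zjf (f≢ ∘ sym))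

    regularity : Regular (inj₁ y) (cY q) (bY q)
    regularity = regular Yy δ δ-root δ-adjacent walk (cY q) (bY q) counts

    valency : HasSize (Adj (inj₁ y)) (q + 2)
    valency = HasSize-cong proj₁ (_, tt) (neighbours-of-point Yy {R = λ _ → ⊤} (mk⇔ id id) all-classes)

    eccentricity-4 : Eccentricity (inj₁ y) 4
    eccentricity-4 = eccentricity Yy δ δ-root δ-adjacent walk 4 (λ {u} _ → δ≤4 {u}) farthest
      where
      farthest : ∃[ u ] Vtx u × δ u ≡ 4
      farthest with avoid-two Carrier-cardinality _≟F_ 3≤q (h Fin.zero · x) (h Fin.zero · y)
      ... | f , f≢x , f≢y with HasSize-inhabited (exterior-to-both xy-exterior (f≢x ∘ sym) (f≢y ∘ sym)) (ℕ.m<n⇒0<n∸m c₃<ℓ)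
      ... | w , (_ , ext-x) , ext-y = inj₁ w , from InY⇔ExteriorJoin ext-x , from δ-point≡4⇔ ext-y

  module FromPlane {i c} (Zic : InZ (i , c)) where
    δ : Vertex → ℕ
    δ (inj₁ w) with h i · w ≟F c
    ... | yes _ = 1
    ... | no  _ = 3
    δ (inj₂ (j , f)) with j Fin.≟ i | f ≟F c
    ... | yes _ | yes _ = 0
    ... | yes _ | no  _ = 4
    ... | no  _ | _     = 2

    δ-root : δ (inj₂ (i , c)) ≡ 0
    δ-root with i Fin.≟ i | c ≟F c
    ... | yes _   | yes _   = refl
    ... | yes _   | no  c≢c = ⊥-elim (c≢c refl)
    ... | no  i≢i | _       = ⊥-elim (i≢i refl)

    δ-point≡1⇔ : ∀ {w} → δ (inj₁ w) ≡ 1 ⇔ h i · w ≡ c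
    δ-point≡1⇔ {w} with h i · w ≟F c
    ... | yes on  = mk⇔ (λ _ → on) (λ _ → refl)
    ... | no  off = mk⇔ (λ ()) (⊥-elim ∘ off)

    δ-point≡3⇔ : ∀ {w} → δ (inj₁ w) ≡ 3 ⇔ h i · w ≢ c
    δ-point≡3⇔ {w} with h i · w ≟F c
    ... | yes on  = mk⇔ (λ ()) (λ off → ⊥-elim (off on))
    ... | no  off = mk⇔ (λ _ → off) (λ _ → refl)

    δ-point≢0 : ∀ {w} → δ (inj₁ w) ≢ 0
    δ-point≢0 {w} with h i · w ≟F c
    ... | yes _ = λ ()
    ... | no  _ = λ ()

    δ-point≢5 : ∀ {w} → δ (inj₁ w) ≢ 5
    δ-point≢5 {w} with h i · w ≟F c
    ... | yes _ = λ ()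
    ... | no  _ = λ ()

    δ-point≤3 : ∀ {w} → δ (inj₁ w) ≤ 3
    δ-point≤3 {w} with h i · w ≟F c
    ... | yes _ = s≤s z≤n
    ... | no  _ = ℕ.≤-refl

    δ-plane≡0⇔ : ∀ {j f} → δ (inj₂ (j , f)) ≡ 0 ⇔ (j ≡ i × f ≡ c)
    δ-plane≡0⇔ {j} {f} with j Fin.≟ i | f ≟F c
    ... | yes j≡i | yes f≡c = mk⇔ (λ _ → j≡i , f≡c) (λ _ → refl)
    ... | yes _   | no  f≢c = mk⇔ (λ ()) (λ (_ , f≡c) → ⊥-elim (f≢c f≡c))
    ... | no  j≢i | _       = mk⇔ (λ ()) (λ (j≡i , _) → ⊥-elim (j≢i j≡i))

    δ-plane≡2⇔ : ∀ {j f} → δ (inj₂ (j , f)) ≡ 2 ⇔ j ≢ i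
    δ-plane≡2⇔ {j} {f} with j Fin.≟ i | f ≟F c
    ... | yes j≡i | yes _ = mk⇔ (λ ()) (λ j≢i → ⊥-elim (j≢i j≡i))
    ... | yes j≡i | no  _ = mk⇔ (λ ()) (λ j≢i → ⊥-elim (j≢i j≡i))
    ... | no  j≢i | _     = mk⇔ (λ _ → j≢i) (λ _ → refl)

    δ-plane≡4⇔ : ∀ {j f} → δ (inj₂ (j , f)) ≡ 4 ⇔ (j ≡ i × f ≢ c)
    δ-plane≡4⇔ {j} {f} with j Fin.≟ i | f ≟F c
    ... | yes _   | yes f≡c = mk⇔ (λ ()) (λ (_ , f≢c) → ⊥-elim (f≢c f≡c))
    ... | yes j≡i | no  f≢c = mk⇔ (λ _ → j≡i , f≢c) (λ _ → refl)
    ... | no  j≢i | _       = mk⇔ (λ ()) (λ (j≡i , _) → ⊥-elim (j≢i j≡i))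

    δ-plane≤4 : ∀ {z} → δ (inj₂ z) ≤ 4
    δ-plane≤4 {j , f} with j Fin.≟ i | f ≟F c
    ... | yes _ | yes _ = z≤n
    ... | yes _ | no  _ = ℕ.≤-refl
    ... | no  _ | _     = s≤s (s≤s z≤n)

    δ-plane≤2 : ∀ {j f} → (j ≡ i → f ≡ c) → δ (inj₂ (j , f)) ≤ 2
    δ-plane≤2 {j} {f} j≡i⇒f≡c with j Fin.≟ i | f ≟F c
    ... | yes _   | yes _   = z≤n
    ... | yes j≡i | no  f≢c = ⊥-elim (f≢c (j≡i⇒f≡c j≡i))
    ... | no  _   | _       = ℕ.≤-refl

    δ-adjacent : ∀ {u v} → Adj u v → δ v ≤ suc (δ u)
    δ-adjacent {inj₁ w} {inj₂ (j , f)} (_ , _ , on) with h i · w ≟F c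
    ... | yes on-root = δ-plane≤2 (λ { refl → trans (sym on) on-root })
    ... | no  _       = δ-plane≤4
    δ-adjacent {inj₂ (j , f)} {inj₁ w} (_ , _ , on) with j Fin.≟ i | f ≟F c
    ... | yes refl | yes refl = ℕ.≤-reflexive (from δ-point≡1⇔ on)
    ... | yes _    | no  _    = ℕ.≤-trans δ-point≤3 (ℕ.m≤n⇒m≤1+n (ℕ.n≤1+n 3))
    ... | no  _    | _        = δ-point≤3

    δ≤4 : ∀ {u} → δ u ≤ 4
    δ≤4 {inj₁ _} = ℕ.m≤n⇒m≤1+n δ-point≤3
    δ≤4 {inj₂ _} = δ-plane≤4

    walk-other-class : ∀ {j f} → InZ (j , f) → j ≢ i → Walk (inj₂ (i , c)) (inj₂ (j , f)) 2
    walk-other-class Zjf j≢i with HasSize-inhabited (exterior-on-line (j≢i ∘ sym) Zic Zjf) 0<q/2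
    ... | w , (on-i , on-j) , ext =
      cons {b = inj₁ w} (from InY⇔ExteriorJoin ext , Zic , on-i) (cons (from InY⇔ExteriorJoin ext , Zjf , on-j) nil)

    walk-point : ∀ {w} → InY w → Walk (inj₂ (i , c)) (inj₁ w) 3
    walk-point {w} Yw with another i
    ... | j , i≢j = snoc (walk-other-class Zj (i≢j ∘ sym)) (Yw , Zj , refl)
      where Zj = λ e → to InY⇔ExteriorJoin Yw j (sym e)

    walk-parallel : ∀ {f} → InZ (i , f) → Walk (inj₂ (i , c)) (inj₂ (i , f)) 4
    walk-parallel Zif with HasSize-inhabited (exterior-on-plane Zif) (ℕ.≤-trans (s≤s z≤n) c₃<ℓ)
    ... | w , on , ext = snoc (walk-point (from InY⇔ExteriorJoin ext)) (from InY⇔ExteriorJoin ext , Zif , on)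

    walk : ∀ {u} → Vtx u → Walk (inj₂ (i , c)) u (δ u)
    walk {inj₁ w} Yw with h i · w ≟F c
    ... | yes on = cons (Yw , Zic , on) nil
    ... | no  _  = walk-point Yw
    walk {inj₂ (j , f)} Zjf with j Fin.≟ i | f ≟F c
    ... | yes refl | yes refl = nil
    ... | yes refl | no  _    = walk-parallel Zjf
    ... | no  j≢i  | _        = walk-other-class Zjf j≢i

    counts : ∀ {u} → Vtx u → HasSize (λ v → Adj u v × δ v ≡ δ u ∸ 1) (cZ q (δ u))
                           × HasSize (λ v → Adj u v × δ v ≡ suc (δ u)) (bZ q (δ u))
    counts {inj₁ w} Yw with h i · w ≟F c
    ... | yes on-root =
      neighbours-of-point Yw (mk⇔ (proj₁ ∘ to δ-plane≡0⇔) (λ j≡i → from δ-plane≡0⇔ (j≡i , subst (λ k → h k · w ≡ c) (sym j≡i) on-root)))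
                          (HasSize-≡ i) ,
      neighbours-of-point Yw δ-plane≡2⇔ (other-classes i)
    ... | no off-root =
      neighbours-of-point Yw δ-plane≡2⇔ (other-classes i) ,
      neighbours-of-point Yw (mk⇔ (proj₁ ∘ to δ-plane≡4⇔) (λ j≡i → from δ-plane≡4⇔ (j≡i , subst (λ k → h k · w ≢ c) (sym j≡i) off-root)))
                          (HasSize-≡ i)
    counts {inj₂ (j , f)} Zjf with j Fin.≟ i | f ≟F c
    ... | yes refl | yes refl =
      neighbours-of-plane Zjf (λ _ _ → mk⇔ δ-point≢0 ⊥-elim) (empty⇒HasSize-0 proj₂) ,
      neighbours-of-plane Zjf (λ on _ → mk⇔ (λ _ → tt) (λ _ → from δ-point≡1⇔ on)) (HasSize-cong (_, tt) proj₁ (exterior-on-plane Zjf))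
    ... | yes refl | no f≢c =
      neighbours-of-plane Zjf (λ on _ → mk⇔ (λ _ → tt) (λ _ → from δ-point≡3⇔ (f≢c ∘ trans (sym on)))) (HasSize-cong (_, tt) proj₁ (exterior-on-plane Zjf)) ,
      neighbours-of-plane Zjf (λ _ _ → mk⇔ δ-point≢5 ⊥-elim) (empty⇒HasSize-0 proj₂)
    ... | no j≢i | _ =
      neighbours-of-plane Zjf (λ _ _ → δ-point≡1⇔) on-both ,
      neighbours-of-plane Zjf (λ _ _ → δ-point≡3⇔) (HasSize-complement (exterior-on-plane Zjf) (λ w → h i · w ≟F c) on-both)
      where
      on-both : HasSize (λ w → (h j · w ≡ f × ExteriorJoin x w) × h i · w ≡ c) (q / 2)
      on-both = HasSize-cong (λ ((on-i , on-j) , ext) → (on-j , ext) , on-i) (λ ((on-j , ext) , on-i) → (on-i , on-j) , ext)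
        (exterior-on-line (j≢i ∘ sym) Zic Zjf)

    regularity : Regular (inj₂ (i , c)) (cZ q) (bZ q)
    regularity = regular Zic δ δ-root δ-adjacent walk (cZ q) (bZ q) counts

    valency : HasSize (Adj (inj₂ (i , c))) (ℓ q)
    valency = HasSize-cong proj₁ (_, tt)
      (neighbours-of-plane Zic {R = λ _ → ⊤} (λ _ _ → mk⇔ id id) (HasSize-cong (_, tt) proj₁ (exterior-on-plane Zic)))

    eccentricity-4 : Eccentricity (inj₂ (i , c)) 4
    eccentricity-4 = eccentricity Zic δ δ-root δ-adjacent walk 4 (λ {u} _ → δ≤4 {u}) farthest
      where
      farthest : ∃[ u ] Vtx u × δ u ≡ 4
      farthest with avoid-two Carrier-cardinality _≟F_ 3≤q c (h i · x)
      ... | f , f≢c , f≢x = inj₂ (i , f) , f≢x ∘ sym , from δ-plane≡4⇔ (refl , f≢c)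

  intersection-array : HasIntersectionArray (q + 2) (1 ∷ 2 ∷ c₃ q ∷ q + 2 ∷ []) (ℓ q) (1 ∷ q / 2 ∷ q + 1 ∷ ℓ q ∷ [])
  intersection-array =
    cY q , bY q , cZ q , bZ q ,
    (λ _ Yy → FromPoint.regularity Yy) ,
    (λ _ Zic → FromPlane.regularity Zic) ,
    (λ _ Yy → FromPoint.valency Yy , FromPoint.eccentricity-4 Yy) ,
    (λ _ Zic → FromPlane.valency Zic , FromPlane.eccentricity-4 Zic) ,
    (λ { Fin.zero → refl ; (Fin.suc Fin.zero) → refl ; (Fin.suc (Fin.suc Fin.zero)) → refl ; (Fin.suc (Fin.suc (Fin.suc Fin.zero))) → refl }) ,
    (λ { Fin.zero → refl ; (Fin.suc Fin.zero) → refl ; (Fin.suc (Fin.suc Fin.zero)) → refl ; (Fin.suc (Fin.suc (Fin.suc Fin.zero))) → refl })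

power-of-two : ∀ m → 2 ≤ m → ∃[ r ] 2 ^ m ≡ 4 * suc r
power-of-two (suc (suc k)) (s≤s (s≤s z≤n)) = ℕ.pred (2 ^ k) , (begin
  2 * (2 * 2 ^ k)           ≡⟨ ℕ.*-assoc 2 2 (2 ^ k) ⟨
  4 * 2 ^ k                 ≡⟨ cong (4 *_) (ℕ.suc-pred (2 ^ k) {{ℕ.m^n≢0 2 k}}) ⟨
  4 * suc (ℕ.pred (2 ^ k))  ∎)
  where open ≡-Reasoning

SizeConditions : ℕ → Set
SizeConditions q = 3 ≤ q × 0 < q / 2 × 0 < c₃ q × c₃ q < ℓ q

size-conditions : ∀ r → SizeConditions (4 * suc r)
size-conditions r =
  3≤q , subst (0 <_) (sym q/2≡) (s≤s z≤n) , subst (0 <_) (sym c₃≡) (s≤s z≤n) , subst (c₃ q <_) (sym ℓ≡) (ℕ.m<m+n (c₃ q) (s≤s z≤n))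
  where
  q = 4 * suc r

  3≤q : 3 ≤ q
  3≤q = ℕ.≤-trans (ℕ.n≤1+n 3) (ℕ.*-monoʳ-≤ 4 (s≤s z≤n))

  q/2≡ : q / 2 ≡ 2 * suc r
  q/2≡ = m≡2n⇒m/2≡n (sym (ℕ.*-assoc 2 2 (suc r)))

  c₃≡ : c₃ q ≡ suc (4 * r * r + 9 * r + 4)
  c₃≡ = m≡4n⇒m/4≡n (identity r)
    where
    identity : ∀ r → 4 * suc (4 * r * r + 9 * r + 4) ≡ (4 * suc r + 1) * (4 * suc r)
    identity = solve-∀

  ℓ≡ : ℓ q ≡ c₃ q + suc (4 * r * r + 5 * r)
  ℓ≡ = begin
    ℓ q                                                    ≡⟨ m≡2n⇒m/2≡n (trans (identity r) (cong (q *_) (sym q-1≡))) ⟩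
    suc (4 * r * r + 9 * r + 4) + suc (4 * r * r + 5 * r)  ≡⟨ cong (_+ suc (4 * r * r + 5 * r)) c₃≡ ⟨
    c₃ q + suc (4 * r * r + 5 * r)                         ∎
    where
    open ≡-Reasoning
    identity : ∀ r → 2 * (suc (4 * r * r + 9 * r + 4) + suc (4 * r * r + 5 * r)) ≡ 4 * suc r * (4 * r + 3)
    identity = solve-∀
    q≡1+[4r+3] : ∀ r → 4 * suc r ≡ suc (4 * r + 3)
    q≡1+[4r+3] = solve-∀
    q-1≡ : q ∸ 1 ≡ 4 * r + 3
    q-1≡ = cong (_∸ 1) (q≡1+[4r+3] r)

theorem6p4 : (m : ℕ) → 2 ≤ m → (F : FiniteField (2 ^ m)) →
    (x : Geometry.V3 F) → (h : Fin (suc (suc (2 ^ m))) → Geometry.V3 F) →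
    Geometry.IsDualHyperoval F h →
    BG.HasIntersectionArray (planeGraph F x h)
      (2 ^ m + 2) (1 ∷ 2 ∷ ((2 ^ m + 1) * 2 ^ m) / 4 ∷ 2 ^ m + 2 ∷ [])
      ((2 ^ m * (2 ^ m ∸ 1)) / 2) (1 ∷ 2 ^ m / 2 ∷ 2 ^ m + 1 ∷ (2 ^ m * (2 ^ m ∸ 1)) / 2 ∷ [])
theorem6p4 m 2≤m F x h hyp =
  let r , 2^m≡4[1+r] = power-of-two m 2≤m
      3≤q , 0<q/2 , 0<c₃ , c₃<ℓ = subst SizeConditions (sym 2^m≡4[1+r]) (size-conditions r)
  in PlaneGraph.intersection-array F x h hyp 3≤q 0<q/2 0<c₃ c₃<ℓ
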